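{- Let $t\in\{1,\dots,m\}$. Consider a subproblem $[\ell,r]$ on the path of subproblems maintained by the learned algorithm at time $t$ that is not rebuilt at time $t$. Then for all $u,v\in V$ such that $C_{u,v}(\hat\sigma_{t-1})$ is defined, $$C_{u,v}(\hat\sigma_{t-1})\in[\ell,r]\iff C_{u,v}(\hat\sigma_t)\in[\ell,r].$$
   Context: **Setting.** $V$ is a finite vertex set. $\sigma=e_1,\dots,e_m$ is a sequence of $m$ distinct directed edges on $V$, with $e_t$ arriving at time $t$. For simplicity $m$ is a power of two. A prediction $\hat\sigma$ is a permutation of $\sigma$. **Updated predictions.** $\hat\sigma_0=\hat\sigma$. For $t\ge1$, $e_t$ sits at a position $\hat t\ge t$ in $\hat\sigma_{t-1}$, since $\hat\sigma_{t-1}$ agrees with $\sigma$ on its first $t-1$ positions. The sequence $\hat\sigma_t$ is obtained by moving $e_t$ from position $\hat t$ to position $t$. Edges at positions $t,\dots,\hat t-1$ shift one position later; others are unchanged. **Combining time.** For an edge sequence $\tau$ and $u,v\in V$, the combining time $C_{u,v}(\tau)$ is the smallest $s\in\{0,\dots,m\}$ such that $u,v$ are in the same strongly connected component of the graph on $V$ formed by the first $s$ edges of $\tau$. It is undefined if no such $s$ exists. **Subproblems.** These are the dyadic intervals $[\ell,r]\subseteq[0,m]$ obtained from $[0,m]$ by repeated halving, stopping at length 2. The midpoint is $x=(\ell+r)/2$, and the children are $[\ell,x]$ and $[x,r]$. **Maintained path and rebuilding.** At time $s\ge1$, the algorithm maintains the subproblems on the root-to-node path from $[0,m]$ to the subproblem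 with midpoint $s$. At time $0$ it maintains the path $[0,m],[0,m/2],\dots,[0,2]$. When $e_t$ arrives, the algorithm finds the deepest subproblem $[\ell_1,r_1]$ on the path maintained at time $t-1$ with $\hat t\in[\ell_1,r_1]$. It rebuilds $[\ell_1,r_1]$ with respect to $\hat\sigma_t$. It then repeatedly rebuilds the child containing $t$ of the last rebuilt subproblem, until the subproblem with midpoint $t$ has been rebuilt. The path maintained at time $t$ consists of the ancestors of $[\ell_1,r_1]$ on the old path (which are not rebuilt) together with the rebuilt subproblems. -}

module Defs where

open import Data.Nat using (ℕ; zero; suc; _+_; _∸_; _≤_; _<_; ⌊_/2⌋)
open import Data.Fin using (Fin)
import Data.Fin as Fin
open import Data.List using (List; []; _∷_; take; length)
open import Data.List.Membership.Propositional using (_∈_)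
open import Data.Maybe using (Maybe; just; nothing)
open import Data.Product using (Σ; _×_; _,_)
open import Data.Product.Properties using (≡-dec)
open import Relation.Nullary using (¬_; Dec; yes; no)
open import Relation.Binary.PropositionalEquality using (_≡_; _≢_)

-- Vertices are Fin n; a directed edge is an ordered pair (tail , head).

Edge : ℕ → Set
Edge n = Fin n × Fin n

_≟E_ : ∀ {n} (e f : Edge n) → Dec (e ≡ f)
_≟E_ = ≡-dec Fin._≟_ Fin._≟_

elemAt : ∀ {A : Set} → List A → ℕ → Maybe A
elemAt []       _       = nothing
elemAt (x ∷ xs) zero    = just x
elemAt (x ∷ xs) (suc i) = elemAt xs i

-- 0-indexed position of the first occurrence of e (length if absent)
indexOf : ∀ {n} → Edge n → List (Edge n) → ℕ
indexOf e [] = zero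
indexOf e (x ∷ xs) with e ≟E x
... | yes _ = zero
... | no  _ = suc (indexOf e xs)

removeAt : ∀ {A : Set} → ℕ → List A → List A
removeAt _       []       = []
removeAt zero    (x ∷ xs) = xs
removeAt (suc i) (x ∷ xs) = x ∷ removeAt i xs

insertAt : ∀ {A : Set} → ℕ → A → List A → List A
insertAt zero    a xs       = a ∷ xs
insertAt (suc i) a []       = a ∷ []
insertAt (suc i) a (x ∷ xs) = x ∷ insertAt i a xs

-- Updated predictions.  e_t = elemAt σ (t-1) (t ≥ 1).
-- σ̂_t moves e_t from its position in σ̂_{t-1} to (1-indexed) position t.

moveStep : ∀ {n} → ℕ → Maybe (Edge n) → List (Edge n) → List (Edge n)
moveStep t nothing  τ = τ
moveStep t (just e) τ = insertAt t e (removeAt (indexOf e τ) τ)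

-- predSeq σ σ̂ t  =  σ̂_t
predSeq : ∀ {n} → List (Edge n) → List (Edge n) → ℕ → List (Edge n)
predSeq σ σ̂ zero    = σ̂
predSeq σ σ̂ (suc t) = moveStep t (elemAt σ t) (predSeq σ σ̂ t)

hatAux : ∀ {n} → Maybe (Edge n) → List (Edge n) → ℕ
hatAux nothing  τ = zero
hatAux (just e) τ = suc (indexOf e τ)

-- t̂ for the arrival at time suc t: the 1-indexed position of e_{t+1}
-- in σ̂_t.
hat : ∀ {n} → List (Edge n) → List (Edge n) → ℕ → ℕ
hat σ σ̂ t = hatAux (elemAt σ t) (predSeq σ σ̂ t)

data Reach {n} (τ : List (Edge n)) : Fin n → Fin n → Set where
  here : ∀ {u} → Reach τ u u
  step : ∀ {u w v} → (u , w) ∈ τ → Reach τ w v → Reach τ u v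

SameSCC : ∀ {n} → List (Edge n) → Fin n → Fin n → Set
SameSCC τ u v = Reach τ u v × Reach τ v u

-- IsCombTime τ u v s : C_{u,v}(τ) is defined and equals s
IsCombTime : ∀ {n} → List (Edge n) → Fin n → Fin n → ℕ → Set
IsCombTime τ u v s =
  s ≤ length τ × SameSCC (take s τ) u v
    × (∀ s′ → s′ < s → ¬ SameSCC (take s′ τ) u v)

mid : ℕ → ℕ → ℕ
mid ℓ r = ⌊ (ℓ + r) /2⌋

-- Desc ℓ r ℓ′ r′ : [ℓ′,r′] is obtained from [ℓ,r] by repeated halving
-- (a descendant-or-self in the subproblem tree); halving only
-- intervals of length > 2.
data Desc : ℕ → ℕ → ℕ → ℕ → Set where
  self  : ∀ {ℓ r} → Desc ℓ r ℓ r
  left  : ∀ {ℓ r ℓ′ r′} → 2 < r ∸ ℓ → Desc ℓ (mid ℓ r) ℓ′ r′ → Desc ℓ r ℓ′ r′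
  right : ∀ {ℓ r ℓ′ r′} → 2 < r ∸ ℓ → Desc (mid ℓ r) r ℓ′ r′ → Desc ℓ r ℓ′ r′

Sub : ℕ → ℕ → ℕ → Set
Sub m ℓ r = Desc 0 m ℓ r

OnPathTo : ℕ → ℕ → ℕ → ℕ → ℕ → Set
OnPathTo m ℓ r ℓ′ r′ = Sub m ℓ r × Desc ℓ r ℓ′ r′

Maintained : ℕ → ℕ → ℕ → ℕ → Set
Maintained m zero    ℓ r = OnPathTo m ℓ r 0 2
Maintained m (suc s) ℓ r =
  Σ ℕ λ ℓ′ → Σ ℕ λ r′ → mid ℓ′ r′ ≡ suc s × Sub m ℓ′ r′ × OnPathTo m ℓ r ℓ′ r′

_∈[_,_] : ℕ → ℕ → ℕ → Set
x ∈[ ℓ , r ] = ℓ ≤ x × x ≤ r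

-- [ℓ₁,r₁] is the deepest subproblem on the path maintained at time t
-- (= suc t′, so time t−1 = t′) that contains t̂.
Deepest : ∀ {n} → ℕ → List (Edge n) → List (Edge n) → ℕ → ℕ → ℕ → Set
Deepest m σ σ̂ t′ ℓ₁ r₁ =
  Maintained m t′ ℓ₁ r₁ × hat σ σ̂ t′ ∈[ ℓ₁ , r₁ ]
    × (∀ ℓ r → Maintained m t′ ℓ r → hat σ σ̂ t′ ∈[ ℓ , r ] → Desc ℓ r ℓ₁ r₁)

-- [ℓ,r] is on the path maintained at time suc t′ and is not rebuilt at
-- time suc t′: it is a proper ancestor of [ℓ₁,r₁] on the old path.
NotRebuilt : ∀ {n} → ℕ → List (Edge n) → List (Edge n) → ℕ → ℕ → ℕ → Set
NotRebuilt m σ σ̂ t′ ℓ r =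
  Maintained m t′ ℓ r ×
  (Σ ℕ λ ℓ₁ → Σ ℕ λ r₁ → Deepest m σ σ̂ t′ ℓ₁ r₁
     × Desc ℓ r ℓ₁ r₁ × ¬ (ℓ ≡ ℓ₁ × r ≡ r₁))

{-# OPTIONS --safe #-}
module Submission where

-- Moving e_t from position t̂ to position t leaves every prefix of length
-- < min(t, t̂) unchanged and permutes every prefix of length ≥ max(t, t̂).
-- Whether u and v are strongly connected by a prefix depends only on its
-- set of edges and is monotone in the prefix length, so a combining time
-- either does not change or lies in [min(t, t̂), max(t, t̂)] both before and
-- after the move.  Every subproblem on the path maintained at time t − 1
-- contains t − 1 and t, and one that is an ancestor of the deepest
-- subproblem containing t̂ also contains t̂; hence it contains that whole
-- interval.

open import Defs
open import Data.Nat using (ℕ; zero; suc; _^_; _≤_; _<_; _+_; _∸_; _⊓_; _⊔_; s≤s; s≤s⁻¹; z<s; ⌊_/2⌋; _≤?_; _<?_)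
open import Data.Nat.Properties
open import Data.Fin using (Fin)
open import Data.List using (List; []; _∷_; length; take)
open import Data.List.Membership.Propositional using (_∈_)
open import Data.List.Relation.Unary.Any using (here; there)
open import Data.List.Relation.Unary.Unique.Propositional using (Unique)
open import Data.List.Relation.Binary.Subset.Propositional using (_⊆_)
open import Data.List.Relation.Binary.Subset.Propositional.Properties using (⊆-reflexive-↭)
open import Data.List.Relation.Binary.Permutation.Propositional
  using (_↭_; refl; prep; swap; trans; ↭-sym; ↭-reflexive)
open import Data.List.Relation.Binary.Permutation.Propositional.Properties using (∈-resp-↭; ↭-length)
open import Data.Maybe using (Maybe; just; nothing)
open import Data.Product using (_×_; _,_; proj₁; proj₂)
open import Data.Sum using (_⊎_; inj₁; inj₂)
open import Function.Bundles using (_⇔_; mk⇔; Equivalence)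
import Function.Properties.Equivalence as ⇔
open import Relation.Nullary using (¬_; yes; no; contradiction)
open import Relation.Binary.PropositionalEquality using (_≡_; refl; sym; cong; subst) renaming (trans to ≡-trans)

Least : (ℕ → Set) → ℕ → Set
Least P c = P c × (∀ s → s < c → ¬ P s)

UpwardClosed : (ℕ → Set) → Set
UpwardClosed P = ∀ {s s′} → s ≤ s′ → P s → P s′

EqualUnlessWithin : ℕ → ℕ → ℕ → ℕ → Set
EqualUnlessWithin a b c c′ = c ≡ c′ ⊎ (c ∈[ a , b ] × c′ ∈[ a , b ])

EqualUnlessWithin-∈⇔ : ∀ {a b ℓ r c c′} → ℓ ≤ a → b ≤ r →
  EqualUnlessWithin a b c c′ → (c ∈[ ℓ , r ]) ⇔ (c′ ∈[ ℓ , r ])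
EqualUnlessWithin-∈⇔ _ _ (inj₁ refl) = ⇔.refl
EqualUnlessWithin-∈⇔ ℓ≤a b≤r (inj₂ ((a≤c , c≤b) , (a≤c′ , c′≤b))) =
  mk⇔ (λ _ → ≤-trans ℓ≤a a≤c′ , ≤-trans c′≤b b≤r) (λ _ → ≤-trans ℓ≤a a≤c , ≤-trans c≤b b≤r)

least-unique : ∀ {P : ℕ → Set} {c c′} → Least P c → Least P c′ → c ≡ c′
least-unique (Pc , c-min) (Pc′ , c′-min) =
  ≤-antisym (≮⇒≥ λ c′<c → c-min _ c′<c Pc′) (≮⇒≥ λ c<c′ → c′-min _ c<c′ Pc)

module _ {P Q : ℕ → Set} {c c′ : ℕ} (a b : ℕ)
         (agree-below : ∀ {s} → s ≤ a → P s ⇔ Q s)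
         (agree-above : ∀ {s} → b ≤ s → P s ⇔ Q s)
         (least-P : Least P c) (least-Q : Least Q c′) where

  private
    Pc = proj₁ least-P
    Qc′ = proj₁ least-Q
    P-min = proj₂ least-P
    Q-min = proj₂ least-Q

  least-equal-below : c ≤ a → c ≡ c′
  least-equal-below c≤a = ≤-antisym c≤c′ c′≤c
    where
    c′≤c : c′ ≤ c
    c′≤c = ≮⇒≥ λ c<c′ → Q-min c c<c′ (Equivalence.to (agree-below c≤a) Pc)
    c≤c′ : c ≤ c′
    c≤c′ = ≮⇒≥ λ c′<c → P-min c′ c′<c (Equivalence.from (agree-below (≤-trans c′≤c c≤a)) Qc′)

  -- Upward closure of Q rules out c′ < b: Q c′ would give Q b, hence P b.
  least-equal-above : UpwardClosed Q → b < c → c ≡ c′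
  least-equal-above Q-up b<c = ≤-antisym c≤c′ c′≤c
    where
    c′≤c : c′ ≤ c
    c′≤c = ≮⇒≥ λ c<c′ → Q-min c c<c′ (Equivalence.to (agree-above (<⇒≤ b<c)) Pc)
    b≤c′ : b ≤ c′
    b≤c′ = ≮⇒≥ λ c′<b → P-min b b<c (Equivalence.from (agree-above ≤-refl) (Q-up (<⇒≤ c′<b) Qc′))
    c≤c′ : c ≤ c′
    c≤c′ = ≮⇒≥ λ c′<c → P-min c′ c′<c (Equivalence.from (agree-above b≤c′) Qc′)

  least-equal-or-within : UpwardClosed Q → c ≡ c′ ⊎ c ∈[ suc a , b ]
  least-equal-or-within Q-up with c ≤? a | b <? c
  ... | yes c≤a | _       = inj₁ (least-equal-below c≤a)
  ... | no _    | yes b<c = inj₁ (least-equal-above Q-up b<c)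
  ... | no c≰a  | no b≮c  = inj₂ (≰⇒> c≰a , ≮⇒≥ b≮c)

least-equalUnlessWithin : ∀ {P Q : ℕ → Set} {c c′} a b → UpwardClosed P → UpwardClosed Q →
  (∀ {s} → s ≤ a → P s ⇔ Q s) → (∀ {s} → b ≤ s → P s ⇔ Q s) →
  Least P c → Least Q c′ → EqualUnlessWithin (suc a) b c c′
least-equalUnlessWithin a b P-up Q-up below above least-P least-Q
  with least-equal-or-within a b below above least-P least-Q Q-up
     | least-equal-or-within a b (λ s≤a → ⇔.sym (below s≤a)) (λ b≤s → ⇔.sym (above b≤s))
                             least-Q least-P P-up
... | inj₁ c≡c′ | _         = inj₁ c≡c′
... | inj₂ _    | inj₁ c′≡c = inj₁ (sym c′≡c)
... | inj₂ c∈   | inj₂ c′∈  = inj₂ (c∈ , c′∈)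

take-⊆-take : ∀ {A : Set} {s s′} (xs : List A) → s ≤ s′ → take s xs ⊆ take s′ xs
take-⊆-take (x ∷ xs) (s≤s s≤s′) (here x≡y)  = here x≡y
take-⊆-take (x ∷ xs) (s≤s s≤s′) (there y∈) = there (take-⊆-take xs s≤s′ y∈)

elemAt-∈ : ∀ {A : Set} {xs : List A} {i x} → elemAt xs i ≡ just x → x ∈ xs
elemAt-∈ {xs = x ∷ xs} {zero}  refl = here refl
elemAt-∈ {xs = x ∷ xs} {suc i} xs[i]≡x = there (elemAt-∈ {xs = xs} {i} xs[i]≡x)

module _ {A : Set} where

  removeAt-↭ : ∀ {xs : List A} {i x} → elemAt xs i ≡ just x → xs ↭ x ∷ removeAt i xs
  removeAt-↭ {y ∷ xs} {zero}  refl    = refl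
  removeAt-↭ {y ∷ xs} {suc i} {x} xs[i]≡x = trans (prep y (removeAt-↭ {xs} {i} xs[i]≡x)) (swap y x refl)

  insertAt-↭ : ∀ j (x : A) xs → insertAt j x xs ↭ x ∷ xs
  insertAt-↭ zero    x xs       = refl
  insertAt-↭ (suc j) x []       = refl
  insertAt-↭ (suc j) x (y ∷ xs) = trans (prep y (insertAt-↭ j x xs)) (swap y x refl)

  take-removeAt : ∀ {s i} (xs : List A) → s ≤ i → take s (removeAt i xs) ≡ take s xs
  take-removeAt {zero}          xs       _         = refl
  take-removeAt {suc s} {suc i} []       _         = refl
  take-removeAt {suc s} {suc i} (y ∷ xs) (s≤s s≤i) = cong (y ∷_) (take-removeAt xs s≤i)

  take-insertAt : ∀ {s j} (x : A) xs → s ≤ j → j ≤ length xs → take s (insertAt j x xs) ≡ take s xs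
  take-insertAt {zero}          x xs       _         _           = refl
  take-insertAt {suc s} {suc j} x (y ∷ xs) (s≤s s≤j) (s≤s j≤|xs|) = cong (y ∷_) (take-insertAt x xs s≤j j≤|xs|)

  take-suc-removeAt : ∀ {s i} {xs : List A} {x} → elemAt xs i ≡ just x → i ≤ s →
    take (suc s) xs ↭ x ∷ take s (removeAt i xs)
  take-suc-removeAt {_}     {zero}  {y ∷ xs} refl    _         = refl
  take-suc-removeAt {suc s} {suc i} {y ∷ xs} {x} xs[i]≡x (s≤s i≤s) =
    trans (prep y (take-suc-removeAt {s} {i} {xs} xs[i]≡x i≤s)) (swap y x refl)

  take-suc-insertAt : ∀ {s j} (x : A) xs → j ≤ s → take (suc s) (insertAt j x xs) ↭ x ∷ take s xs
  take-suc-insertAt {_}     {zero}  x xs       _         = refl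
  take-suc-insertAt {suc s} {suc j} x []       _         = refl
  take-suc-insertAt {suc s} {suc j} x (y ∷ xs) (s≤s j≤s) =
    trans (prep y (take-suc-insertAt x xs j≤s)) (swap y x refl)

  module _ {xs : List A} {i j : ℕ} {x : A} (xs[i]≡x : elemAt xs i ≡ just x) (j<|xs| : j < length xs) where

    take-move-below : ∀ {s} → s ≤ i ⊓ j → take s xs ≡ take s (insertAt j x (removeAt i xs))
    take-move-below s≤i⊓j = sym (≡-trans
      (take-insertAt x _ (≤-trans s≤i⊓j (m⊓n≤n i j)) j≤|removeAt|)
      (take-removeAt xs (≤-trans s≤i⊓j (m⊓n≤m i j))))
      where
      j≤|removeAt| : j ≤ length (removeAt i xs)
      j≤|removeAt| = s≤s⁻¹ (subst (suc j ≤_) (↭-length (removeAt-↭ {xs} {i} xs[i]≡x)) j<|xs|)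

    take-move-above : ∀ {s} → suc (i ⊔ j) ≤ s → take s xs ↭ take s (insertAt j x (removeAt i xs))
    take-move-above {suc s} (s≤s i⊔j≤s) = trans
      (take-suc-removeAt xs[i]≡x (≤-trans (m≤m⊔n i j) i⊔j≤s))
      (↭-sym (take-suc-insertAt x _ (≤-trans (m≤n⊔m i j) i⊔j≤s)))

module _ {n : ℕ} where

  Reach-mono : ∀ {τ τ′ : List (Edge n)} {u v} → τ ⊆ τ′ → Reach τ u v → Reach τ′ u v
  Reach-mono τ⊆τ′ here         = here
  Reach-mono τ⊆τ′ (step e∈ uv) = step (τ⊆τ′ e∈) (Reach-mono τ⊆τ′ uv)

  SameSCC-mono : ∀ {τ τ′ : List (Edge n)} {u v} → τ ⊆ τ′ → SameSCC τ u v → SameSCC τ′ u v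
  SameSCC-mono τ⊆τ′ (uv , vu) = Reach-mono τ⊆τ′ uv , Reach-mono τ⊆τ′ vu

  SameSCC-resp-↭ : ∀ {τ τ′ : List (Edge n)} {u v} → τ ↭ τ′ → SameSCC τ u v ⇔ SameSCC τ′ u v
  SameSCC-resp-↭ τ↭τ′ = mk⇔ (SameSCC-mono (⊆-reflexive-↭ τ↭τ′)) (SameSCC-mono (⊆-reflexive-↭ (↭-sym τ↭τ′)))

  SameSCC-take-upwardClosed : ∀ (τ : List (Edge n)) u v → UpwardClosed (λ s → SameSCC (take s τ) u v)
  SameSCC-take-upwardClosed τ u v s≤s′ = SameSCC-mono (take-⊆-take τ s≤s′)

  combTime-equalUnlessWithin : ∀ {τ τ′ : List (Edge n)} {u v c c′} a b →
    (∀ {s} → s ≤ a → take s τ ↭ take s τ′) → (∀ {s} → b ≤ s → take s τ ↭ take s τ′) →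
    IsCombTime τ u v c → IsCombTime τ′ u v c′ → EqualUnlessWithin (suc a) b c c′
  combTime-equalUnlessWithin {τ} {τ′} {u} {v} a b below above (_ , least) (_ , least′) =
    least-equalUnlessWithin a b (SameSCC-take-upwardClosed τ u v) (SameSCC-take-upwardClosed τ′ u v)
      (λ s≤a → SameSCC-resp-↭ (below s≤a)) (λ b≤s → SameSCC-resp-↭ (above b≤s)) least least′

  indexOf-elemAt : ∀ {e : Edge n} {τ} → e ∈ τ → elemAt τ (indexOf e τ) ≡ just e
  indexOf-elemAt {e} {f ∷ τ} e∈ with e ≟E f | e∈
  ... | yes e≡f | _         = cong just (sym e≡f)
  ... | no e≢f  | here e≡f  = contradiction e≡f e≢f
  ... | no _    | there e∈τ = indexOf-elemAt e∈τ

  moveStep-↭ : ∀ t (me : Maybe (Edge n)) τ → (∀ {e} → me ≡ just e → e ∈ τ) → moveStep t me τ ↭ τ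
  moveStep-↭ t nothing  τ _  = refl
  moveStep-↭ t (just e) τ e∈ =
    trans (insertAt-↭ t e _) (↭-sym (removeAt-↭ {xs = τ} (indexOf-elemAt (e∈ refl))))

  predSeq-↭ : ∀ (σ σ̂ : List (Edge n)) → σ̂ ↭ σ → ∀ t → predSeq σ σ̂ t ↭ σ
  predSeq-↭ σ σ̂ σ̂↭σ zero    = σ̂↭σ
  predSeq-↭ σ σ̂ σ̂↭σ (suc t) =
    trans (moveStep-↭ t (elemAt σ t) _ (λ σ[t]≡e → ∈-resp-↭ (↭-sym τ↭σ) (elemAt-∈ σ[t]≡e))) τ↭σ
    where
    τ↭σ : predSeq σ σ̂ t ↭ σ
    τ↭σ = predSeq-↭ σ σ̂ σ̂↭σ t

  moveStep-combTime : ∀ t (me : Maybe (Edge n)) τ {u v c c′} → (∀ {e} → me ≡ just e → e ∈ τ) → t < length τ →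
    IsCombTime τ u v c → IsCombTime (moveStep t me τ) u v c′ →
    EqualUnlessWithin (hatAux me τ ⊓ suc t) (hatAux me τ ⊔ suc t) c c′
  moveStep-combTime t nothing  τ _  _      (_ , least) (_ , least′) = inj₁ (least-unique least least′)
  moveStep-combTime t (just e) τ e∈ t<|τ| =
    combTime-equalUnlessWithin (i ⊓ t) (suc (i ⊔ t))
      (λ s≤i⊓t → ↭-reflexive (take-move-below τ[i]≡e t<|τ| s≤i⊓t)) (take-move-above τ[i]≡e t<|τ|)
    where
    i = indexOf e τ
    τ[i]≡e = indexOf-elemAt (e∈ refl)

mid-+ : ∀ ℓ d → mid ℓ (ℓ + d) ≡ ℓ + ⌊ d /2⌋
mid-+ zero    d = refl
mid-+ (suc ℓ) d rewrite +-suc ℓ (ℓ + d) = cong suc (mid-+ ℓ d)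

mid-within : ∀ {ℓ r} → ℓ < r → ℓ ≤ mid ℓ r × mid ℓ r < r
mid-within {ℓ} {r} ℓ<r =
  subst (λ x → ℓ ≤ mid ℓ x × mid ℓ x < x) (m+[n∸m]≡n (<⇒≤ ℓ<r)) (bounds (r ∸ ℓ) (m<n⇒0<n∸m ℓ<r))
  where
  bounds : ∀ d → 0 < d → ℓ ≤ mid ℓ (ℓ + d) × mid ℓ (ℓ + d) < ℓ + d
  bounds (suc d) _ rewrite mid-+ ℓ (suc d) = m≤m+n ℓ _ , +-monoʳ-< ℓ (⌊n/2⌋<n d)

mid-strictly-within : ∀ {ℓ r} → 1 < r ∸ ℓ → ℓ < mid ℓ r × mid ℓ r < r
mid-strictly-within {ℓ} {r} 1<r∸ℓ =
  subst (λ x → ℓ < mid ℓ x) (m+[n∸m]≡n (<⇒≤ ℓ<r)) (lower (r ∸ ℓ) 1<r∸ℓ) , proj₂ (mid-within ℓ<r)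
  where
  ℓ<r : ℓ < r
  ℓ<r = m∸n≢0⇒n<m (>⇒≢ (<-trans z<s 1<r∸ℓ))
  lower : ∀ d → 1 < d → ℓ < mid ℓ (ℓ + d)
  lower (suc zero)    (s≤s ())
  lower (suc (suc d)) _ rewrite mid-+ ℓ (suc (suc d)) = m<m+n ℓ z<s

Desc-⊆ : ∀ {ℓ r ℓ′ r′} → Desc ℓ r ℓ′ r′ → ℓ ≤ ℓ′ × r′ ≤ r
Desc-⊆ self = ≤-refl , ≤-refl
Desc-⊆ (left 2<r∸ℓ d) with Desc-⊆ d
... | ℓ≤ℓ′ , r′≤mid = ℓ≤ℓ′ , ≤-trans r′≤mid (<⇒≤ (proj₂ (mid-strictly-within (<⇒≤ 2<r∸ℓ))))
Desc-⊆ (right 2<r∸ℓ d) with Desc-⊆ d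
... | mid≤ℓ′ , r′≤r = ≤-trans (<⇒≤ (proj₁ (mid-strictly-within (<⇒≤ 2<r∸ℓ)))) mid≤ℓ′ , r′≤r

Desc-nonempty : ∀ {ℓ r ℓ′ r′} → Desc ℓ r ℓ′ r′ → ℓ < r → ℓ′ < r′
Desc-nonempty self          ℓ<r = ℓ<r
Desc-nonempty (left 2<r∸ℓ d)  _ = Desc-nonempty d (proj₁ (mid-strictly-within (<⇒≤ 2<r∸ℓ)))
Desc-nonempty (right 2<r∸ℓ d) _ = Desc-nonempty d (proj₂ (mid-strictly-within (<⇒≤ 2<r∸ℓ)))

Maintained-straddles : ∀ {m t ℓ r} → 0 < m → Maintained m t ℓ r → ℓ ≤ t × t < r
Maintained-straddles {t = zero} _ (_ , on-path) with Desc-⊆ on-path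
... | ℓ≤0 , 2≤r = ℓ≤0 , <-≤-trans z<s 2≤r
Maintained-straddles {t = suc s} 0<m (ℓ′ , r′ , mid≡t , sub , _ , on-path)
  with Desc-⊆ on-path | mid-within (Desc-nonempty sub 0<m)
... | ℓ≤ℓ′ , r′≤r | ℓ′≤mid , mid<r′ rewrite mid≡t = ≤-trans ℓ≤ℓ′ ℓ′≤mid , <-≤-trans mid<r′ r′≤r

lemma7 : ∀ {n : ℕ} (k : ℕ) (σ σ̂ : List (Edge n)) →
    length σ ≡ 2 ^ k → Unique σ → σ̂ ↭ σ →
    (t′ : ℕ) → suc t′ ≤ 2 ^ k →
    (ℓ r : ℕ) → NotRebuilt (2 ^ k) σ σ̂ t′ ℓ r →
    (u v : Fin n) (s s′ : ℕ) →
    IsCombTime (predSeq σ σ̂ t′) u v s →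
    IsCombTime (predSeq σ σ̂ (suc t′)) u v s′ →
    (s ∈[ ℓ , r ]) ⇔ (s′ ∈[ ℓ , r ])
lemma7 k σ σ̂ |σ|≡2^k _ σ̂↭σ t′ t<2^k ℓ r
       (maintained , _ , _ , (_ , (ℓ₁≤t̂ , t̂≤r₁) , _) , ancestor , _) u v s s′ cs cs′ =
  EqualUnlessWithin-∈⇔ (⊓-glb ℓ≤t̂ (m≤n⇒m≤1+n ℓ≤t′)) (⊔-lub t̂≤r t′<r)
    (moveStep-combTime t′ (elemAt σ t′) τ e∈τ t′<|τ| cs cs′)
  where
  τ : List (Edge _)
  τ = predSeq σ σ̂ t′
  τ↭σ : τ ↭ σ
  τ↭σ = predSeq-↭ σ σ̂ σ̂↭σ t′
  e∈τ : ∀ {e} → elemAt σ t′ ≡ just e → e ∈ τ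
  e∈τ σ[t′]≡e = ∈-resp-↭ (↭-sym τ↭σ) (elemAt-∈ σ[t′]≡e)
  t′<|τ| : t′ < length τ
  t′<|τ| = subst (t′ <_) (sym (≡-trans (↭-length τ↭σ) |σ|≡2^k)) t<2^k
  ℓ≤t′ : ℓ ≤ t′
  ℓ≤t′ = proj₁ (Maintained-straddles (m^n>0 2 k) maintained)
  t′<r : t′ < r
  t′<r = proj₂ (Maintained-straddles (m^n>0 2 k) maintained)
  ℓ≤t̂ : ℓ ≤ hat σ σ̂ t′
  ℓ≤t̂ = ≤-trans (proj₁ (Desc-⊆ ancestor)) ℓ₁≤t̂
  t̂≤r : hat σ σ̂ t′ ≤ r
  t̂≤r = ≤-trans t̂≤r₁ (proj₂ (Desc-⊆ ancestor))
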